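{- Let $p$ be a prime and $r\ge1$ an integer. Let $f\in\mathbb{Q}[x]$ be a $p^r$-pure polynomial of degree $d>1$. Suppose $g(x)=bx^e+p^sh(x)\in\mathbb{Q}[x]$, with $e\ge1$, $\nu_p(b)=0$, $h\in\mathbb{Q}[x]$, $\deg(h)\le e-1$, $\nu_p(h)\ge0$, and $s$ an integer with $s>\frac{r}{d}$. Then $f\circ g$ is $p^r$-pure.
   Context: $\nu_p$ denotes the $p$-adic valuation on $\mathbb{Q}$ (with $\nu_p(0)=\infty$); for $h=\sum h_ix^i\in\mathbb{Q}[x]$, $\nu_p(h)=\min_i\nu_p(h_i)$. A polynomial $q(x)=a_nx^n+\dots+a_0\in\mathbb{Q}[x]$ of degree $n$ is $p^r$-pure if $\nu_p(a_n)=0$, $\nu_p(a_0)=r$, and $\frac{\nu_p(a_i)}{n-i}\ge\frac{r}{n}$ for all $1\le i\le n-1$. -}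

module Defs where

open import Data.Nat as ℕ using (ℕ; zero; suc)
open import Data.Integer as ℤ using (ℤ; +_)
open import Data.Integer.Divisibility as ℤD using ()
open import Data.Nat.Divisibility as ℕD using ()
open import Data.Rational as ℚ using (ℚ; _/_; 0ℚ; 1ℚ)
open import Data.List using (List; []; _∷_)
open import Data.Product using (Σ; ∃; _×_)
open import Data.Sum using (_⊎_)
open import Relation.Binary.PropositionalEquality using (_≡_)
open import Relation.Nullary using (¬_)

ι : ℕ → ℚ
ι n = (+ n) / 1

qpow : ℚ → ℕ → ℚ
qpow q zero    = 1ℚ
qpow q (suc n) = q ℚ.* qpow q n

-- ValIs p a k  :  a ≠ 0 and ν_p(a) = k, i.e.
-- a · p^m = p^n · (u / w) with k = n - m, u ∈ ℤ, w ∈ ℕ nonzero, p ∤ u, p ∤ w.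
ValIs : ℕ → ℚ → ℤ → Set
ValIs p a k =
  Σ ℕ λ n → Σ ℕ λ m → Σ ℤ λ u → Σ ℕ λ w →
    Σ (ℕ.NonZero w) λ nz →
      (k ≡ (+ n) ℤ.- (+ m)) ×
      (¬ ((+ p) ℤD.∣ u)) × (¬ (p ℕD.∣ w)) ×
      (a ℚ.* qpow (ι p) m ≡ qpow (ι p) n ℚ.* (_/_ u w {{nz}}))

-- ν_p(a) ≥ k  (with ν_p(0) = ∞)
ValGe : ℕ → ℤ → ℚ → Set
ValGe p k a = (a ≡ 0ℚ) ⊎ (Σ ℤ λ j → ValIs p a j × (k ℤ.≤ j))

-- Polynomials over ℚ as coefficient lists (constant term first)

Poly : Set
Poly = List ℚ

coeff : Poly → ℕ → ℚ
coeff []       _       = 0ℚ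
coeff (a ∷ as) zero    = a
coeff (a ∷ as) (suc i) = coeff as i

_+ₚ_ : Poly → Poly → Poly
[]       +ₚ q        = q
(a ∷ as) +ₚ []       = a ∷ as
(a ∷ as) +ₚ (b ∷ bs) = (a ℚ.+ b) ∷ (as +ₚ bs)

scale : ℚ → Poly → Poly
scale c []       = []
scale c (a ∷ as) = (c ℚ.* a) ∷ scale c as

shiftX : Poly → Poly
shiftX q = 0ℚ ∷ q

_*ₚ_ : Poly → Poly → Poly
[]       *ₚ q = []
(a ∷ as) *ₚ q = scale a q +ₚ shiftX (as *ₚ q)

_∘ₚ_ : Poly → Poly → Poly
[]       ∘ₚ g = []
(a ∷ as) ∘ₚ g = (a ∷ []) +ₚ (g *ₚ (as ∘ₚ g))

monomial : ℚ → ℕ → Poly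
monomial b zero    = b ∷ []
monomial b (suc e) = 0ℚ ∷ monomial b e

HasDegree : Poly → ℕ → Set
HasDegree q n = (¬ (coeff q n ≡ 0ℚ)) × (∀ i → n ℕ.< i → coeff q i ≡ 0ℚ)

-- deg q ≤ m (the zero polynomial included)
DegreeLe : Poly → ℕ → Set
DegreeLe q m = ∀ i → m ℕ.< i → coeff q i ≡ 0ℚ

PolyValGe : ℕ → ℤ → Poly → Set
PolyValGe p k q = ∀ i → ValGe p k (coeff q i)

-- q is p^r-pure: for n = deg q,
--   ν_p(a_n) = 0, ν_p(a_0) = r, and ν_p(a_i)/(n-i) ≥ r/n for 1 ≤ i ≤ n-1
-- (the last condition written as  r·(n-i) ≤ n·ν_p(a_i), vacuous if a_i = 0).
IsPure : ℕ → ℕ → Poly → Set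
IsPure p r q = Σ ℕ λ n →
  HasDegree q n ×
  ValIs p (coeff q n) (+ 0) ×
  ValIs p (coeff q 0) (+ r) ×
  (∀ i → 1 ℕ.≤ i → i ℕ.< n →
     (coeff q i ≡ 0ℚ) ⊎
     (Σ ℤ λ j → ValIs p (coeff q i) j × ((+ (r ℕ.* (n ℕ.∸ i))) ℤ.≤ (+ n) ℤ.* j)))

-- Say that q lies above the line (a, B, t) when a·ν_p(qᵢ) + B·i ≥ t for every nonzero coefficient qᵢ.
-- This is stable under sums, adds the heights t under products, and is stable under substitution:
-- if L lies above (a, G, T) and g above (a, B, G), then L ∘ g lies above (a, B, T).
-- A p^r-pure f of degree d lies above (d, r, dr), hence above (de, re, dre), and g = b x^e + p^s h
-- lies above (de, r, re) because ds > r; so f ∘ g lies above (de, r, dre): the slope condition for f ∘ g.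
-- Its leading coefficient is a_d b^d, a p-adic unit. For the constant term write f = a₀ + x f₁:
-- f₁ lies above (d, r+1, dr - r) and g above (d, r+1, r+1), so the constant term of g·(f₁ ∘ g)
-- has valuation > r and does not disturb ν_p(a₀) = r.

module Submission where

open import Algebra.Bundles using (CommutativeMonoid)
import Algebra.Properties.CommutativeSemigroup as CommSemigroupProperties
open import Data.Empty using (⊥-elim)
open import Data.Integer as ℤ using (ℤ; +_; -[1+_])
import Data.Integer.Divisibility.Signed as ℤS
import Data.Integer.Properties as ℤP
open import Data.Integer.Tactic.RingSolver using (solve-∀)
open import Data.List using ([]; _∷_)
open import Data.Nat as ℕ using (ℕ; zero; suc; s≤s; z≤n; _≤_; _<_; _*_; _∸_)
import Data.Nat.Divisibility as ℕD
open import Data.Nat.Induction using (<-rec)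
import Data.Nat.Properties as ℕP
open import Data.Nat.Primality using (Prime; euclidsLemma; prime⇒nonTrivial)
open import Data.Product using (Σ; _×_; _,_; proj₁; proj₂)
open import Data.Rational as ℚ using (ℚ; _/_; 0ℚ; 1ℚ; toℚᵘ)
import Data.Rational.Properties as ℚP
open import Data.Rational.Solver using (module +-*-Solver)
open import Data.Rational.Unnormalised as ℚᵘ using (mkℚᵘ; *≡*; _≃_)
import Data.Rational.Unnormalised.Properties as ℚᵘP
open import Data.Sum using (_⊎_; inj₁; inj₂)
open import Relation.Binary.Definitions using (tri<; tri≈; tri>)
open import Relation.Binary.PropositionalEquality
open import Relation.Nullary using (¬_; yes; no)

open import Defs

open CommSemigroupProperties ℕP.*-commutativeSemigroup using () renaming (xy∙z≈xz∙y to ℕ-xy∙z≈xz∙y)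
open CommSemigroupProperties ℤP.*-commutativeSemigroup using () renaming (interchange to ℤ-interchange)
open CommSemigroupProperties (CommutativeMonoid.commutativeSemigroup ℚP.*-1-commutativeMonoid)
  using () renaming (interchange to ℚ-interchange; x∙yz≈y∙xz to ℚ-x∙yz≈y∙xz)

ιℤ : ℤ → ℚ
ιℤ z = z / 1

toℚᵘ-ιℤ : ∀ z → toℚᵘ (ιℤ z) ≃ mkℚᵘ z 0
toℚᵘ-ιℤ z = ℚP.toℚᵘ-fromℚᵘ (mkℚᵘ z 0)

ιℤ-* : ∀ i j → ιℤ (i ℤ.* j) ≡ ιℤ i ℚ.* ιℤ j
ιℤ-* i j = ℚP.toℚᵘ-injective (begin
  toℚᵘ (ιℤ (i ℤ.* j))           ≈⟨ toℚᵘ-ιℤ (i ℤ.* j) ⟩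
  mkℚᵘ i 0 ℚᵘ.* mkℚᵘ j 0        ≈⟨ ℚᵘP.*-cong (toℚᵘ-ιℤ i) (toℚᵘ-ιℤ j) ⟨
  toℚᵘ (ιℤ i) ℚᵘ.* toℚᵘ (ιℤ j)  ≈⟨ ℚP.toℚᵘ-homo-* (ιℤ i) (ιℤ j) ⟨
  toℚᵘ (ιℤ i ℚ.* ιℤ j)          ∎)
  where open ℚᵘP.≃-Reasoning

ιℤ-+ : ∀ i j → ιℤ (i ℤ.+ j) ≡ ιℤ i ℚ.+ ιℤ j
ιℤ-+ i j = ℚP.toℚᵘ-injective (begin
  toℚᵘ (ιℤ (i ℤ.+ j))           ≈⟨ toℚᵘ-ιℤ (i ℤ.+ j) ⟩
  mkℚᵘ (i ℤ.+ j) 0              ≈⟨ *≡* (over-one i j) ⟩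
  mkℚᵘ i 0 ℚᵘ.+ mkℚᵘ j 0        ≈⟨ ℚᵘP.+-cong (toℚᵘ-ιℤ i) (toℚᵘ-ιℤ j) ⟨
  toℚᵘ (ιℤ i) ℚᵘ.+ toℚᵘ (ιℤ j)  ≈⟨ ℚP.toℚᵘ-homo-+ (ιℤ i) (ιℤ j) ⟨
  toℚᵘ (ιℤ i ℚ.+ ιℤ j)          ∎)
  where
  open ℚᵘP.≃-Reasoning
  over-one : ∀ a b → (a ℤ.+ b) ℤ.* + 1 ≡ (a ℤ.* + 1 ℤ.+ b ℤ.* + 1) ℤ.* + 1
  over-one = solve-∀

ιℤ≡0⇒≡0 : ∀ z → ιℤ z ≡ 0ℚ → z ≡ + 0
ιℤ≡0⇒≡0 z eq with ℚᵘP.≃-trans (ℚᵘP.≃-sym (toℚᵘ-ιℤ z)) (ℚP.toℚᵘ-cong eq)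
... | *≡* e = trans (sym (ℤP.*-identityʳ z)) e

/-*-denominator : ∀ u w → (u / suc w) ℚ.* ι (suc w) ≡ ιℤ u
/-*-denominator u w = ℚP.toℚᵘ-injective (begin
  toℚᵘ ((u / suc w) ℚ.* ι (suc w))          ≈⟨ ℚP.toℚᵘ-homo-* (u / suc w) (ι (suc w)) ⟩
  toℚᵘ (u / suc w) ℚᵘ.* toℚᵘ (ι (suc w))    ≈⟨ ℚᵘP.*-cong (ℚP.toℚᵘ-fromℚᵘ (mkℚᵘ u w)) (toℚᵘ-ιℤ (+ suc w)) ⟩
  mkℚᵘ u w ℚᵘ.* mkℚᵘ (+ suc w) 0            ≈⟨ *≡* (cancel u w) ⟩
  mkℚᵘ u 0                                  ≈⟨ toℚᵘ-ιℤ u ⟨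
  toℚᵘ (ιℤ u)                               ∎)
  where
  open ℚᵘP.≃-Reasoning
  cancel : ∀ u w → (u ℤ.* + suc w) ℤ.* + 1 ≡ u ℤ.* + suc (w ℕ.* 1)
  cancel u w rewrite ℕP.*-identityʳ w = ℤP.*-identityʳ (u ℤ.* + suc w)

*-cancelʳ-≢0 : ∀ x y z → x ℚ.* z ≡ y ℚ.* z → z ≢ 0ℚ → x ≡ y
*-cancelʳ-≢0 x y z eq z≢0 = begin
  x                         ≡⟨ ℚP.*-identityʳ x ⟨
  x ℚ.* 1ℚ                  ≡⟨ cong (x ℚ.*_) (ℚP.*-inverseʳ z) ⟨
  x ℚ.* (z ℚ.* ℚ.1/ z)      ≡⟨ ℚP.*-assoc x z _ ⟨
  (x ℚ.* z) ℚ.* ℚ.1/ z      ≡⟨ cong (ℚ._* ℚ.1/ z) eq ⟩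
  (y ℚ.* z) ℚ.* ℚ.1/ z      ≡⟨ ℚP.*-assoc y z _ ⟩
  y ℚ.* (z ℚ.* ℚ.1/ z)      ≡⟨ cong (y ℚ.*_) (ℚP.*-inverseʳ z) ⟩
  y ℚ.* 1ℚ                  ≡⟨ ℚP.*-identityʳ y ⟩
  y                         ∎
  where
  open ≡-Reasoning
  instance _ = ℚ.≢-nonZero z≢0

coeff-+ₚ : ∀ q r i → coeff (q +ₚ r) i ≡ coeff q i ℚ.+ coeff r i
coeff-+ₚ []      r       i       = sym (ℚP.+-identityˡ (coeff r i))
coeff-+ₚ (a ∷ q) []      i       = sym (ℚP.+-identityʳ (coeff (a ∷ q) i))
coeff-+ₚ (a ∷ q) (b ∷ r) zero    = refl
coeff-+ₚ (a ∷ q) (b ∷ r) (suc i) = coeff-+ₚ q r i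

coeff-scale : ∀ c q i → coeff (scale c q) i ≡ c ℚ.* coeff q i
coeff-scale c []      i       = sym (ℚP.*-zeroʳ c)
coeff-scale c (a ∷ q) zero    = refl
coeff-scale c (a ∷ q) (suc i) = coeff-scale c q i

coeff-monomial-≡ : ∀ c e → coeff (monomial c e) e ≡ c
coeff-monomial-≡ c zero    = refl
coeff-monomial-≡ c (suc e) = coeff-monomial-≡ c e

coeff-monomial-≢ : ∀ c e i → i ≢ e → coeff (monomial c e) i ≡ 0ℚ
coeff-monomial-≢ c zero    zero    i≢e = ⊥-elim (i≢e refl)
coeff-monomial-≢ c zero    (suc i) _   = refl
coeff-monomial-≢ c (suc e) zero    _   = refl
coeff-monomial-≢ c (suc e) (suc i) i≢e = coeff-monomial-≢ c e i (λ i≡e → i≢e (cong suc i≡e))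

IsZero : Poly → Set
IsZero q = ∀ i → coeff q i ≡ 0ℚ

+ₚ-isZero : ∀ q r → IsZero q → IsZero r → IsZero (q +ₚ r)
+ₚ-isZero q r q≈0 r≈0 i = trans (coeff-+ₚ q r i) (trans (cong₂ ℚ._+_ (q≈0 i) (r≈0 i)) (ℚP.+-identityˡ 0ℚ))

*ₚ-isZeroˡ : ∀ q r → IsZero q → IsZero (q *ₚ r)
*ₚ-isZeroˡ []      r q≈0 i = refl
*ₚ-isZeroˡ (c ∷ q) r q≈0 = +ₚ-isZero (scale c r) (shiftX (q *ₚ r)) scaled shifted
  where
  scaled : IsZero (scale c r)
  scaled i = trans (coeff-scale c r i) (trans (cong (ℚ._* coeff r i) (q≈0 0)) (ℚP.*-zeroˡ (coeff r i)))
  shifted : IsZero (shiftX (q *ₚ r))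
  shifted zero    = refl
  shifted (suc i) = *ₚ-isZeroˡ q r (λ j → q≈0 (suc j)) i

*ₚ-isZeroʳ : ∀ q r → IsZero r → IsZero (q *ₚ r)
*ₚ-isZeroʳ []      r r≈0 i = refl
*ₚ-isZeroʳ (c ∷ q) r r≈0 = +ₚ-isZero (scale c r) (shiftX (q *ₚ r)) scaled shifted
  where
  scaled : IsZero (scale c r)
  scaled i = trans (coeff-scale c r i) (trans (cong (c ℚ.*_) (r≈0 i)) (ℚP.*-zeroʳ c))
  shifted : IsZero (shiftX (q *ₚ r))
  shifted zero    = refl
  shifted (suc i) = *ₚ-isZeroʳ q r r≈0 i

∘ₚ-isZero : ∀ L g → IsZero L → IsZero (L ∘ₚ g)
∘ₚ-isZero []      g L≈0 i = refl
∘ₚ-isZero (c ∷ L) g L≈0 =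
  +ₚ-isZero (c ∷ []) (g *ₚ (L ∘ₚ g)) constant (*ₚ-isZeroʳ g (L ∘ₚ g) (∘ₚ-isZero L g (λ i → L≈0 (suc i))))
  where
  constant : IsZero (c ∷ [])
  constant zero    = L≈0 0
  constant (suc i) = refl

*ₚ-top : ∀ q r m n → DegreeLe q m → DegreeLe r n →
         DegreeLe (q *ₚ r) (m ℕ.+ n) × (coeff (q *ₚ r) (m ℕ.+ n) ≡ coeff q m ℚ.* coeff r n)
*ₚ-top []      r m       n deg-q deg-r = (λ _ _ → refl) , sym (ℚP.*-zeroˡ (coeff r n))
*ₚ-top (c ∷ q) r zero    n deg-q deg-r = degree , coeff-cr n
  where
  coeff-cr : ∀ i → coeff ((c ∷ q) *ₚ r) i ≡ c ℚ.* coeff r i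
  coeff-cr i = begin
    coeff (scale c r +ₚ shiftX (q *ₚ r)) i             ≡⟨ coeff-+ₚ (scale c r) (shiftX (q *ₚ r)) i ⟩
    coeff (scale c r) i ℚ.+ coeff (shiftX (q *ₚ r)) i  ≡⟨ cong₂ ℚ._+_ (coeff-scale c r i) (tail≈0 i) ⟩
    c ℚ.* coeff r i ℚ.+ 0ℚ                            ≡⟨ ℚP.+-identityʳ (c ℚ.* coeff r i) ⟩
    c ℚ.* coeff r i                                   ∎
    where
    open ≡-Reasoning
    tail≈0 : IsZero (shiftX (q *ₚ r))
    tail≈0 zero    = refl
    tail≈0 (suc i) = *ₚ-isZeroˡ q r (λ j → deg-q (suc j) (s≤s z≤n)) i
  degree : DegreeLe ((c ∷ q) *ₚ r) n
  degree i n<i = trans (coeff-cr i) (trans (cong (c ℚ.*_) (deg-r i n<i)) (ℚP.*-zeroʳ c))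
*ₚ-top (c ∷ q) r (suc m) n deg-q deg-r = degree , leading
  where
  ih : DegreeLe (q *ₚ r) (m ℕ.+ n) × (coeff (q *ₚ r) (m ℕ.+ n) ≡ coeff q m ℚ.* coeff r n)
  ih = *ₚ-top q r m n (λ i m<i → deg-q (suc i) (s≤s m<i)) deg-r
  coeff-shift : ∀ i → n ℕ.< suc i → coeff ((c ∷ q) *ₚ r) (suc i) ≡ coeff (q *ₚ r) i
  coeff-shift i n<1+i = begin
    coeff (scale c r +ₚ shiftX (q *ₚ r)) (suc i)  ≡⟨ coeff-+ₚ (scale c r) (shiftX (q *ₚ r)) (suc i) ⟩
    coeff (scale c r) (suc i) ℚ.+ coeff (q *ₚ r) i ≡⟨ cong (ℚ._+ coeff (q *ₚ r) i) (coeff-scale c r (suc i)) ⟩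
    c ℚ.* coeff r (suc i) ℚ.+ coeff (q *ₚ r) i    ≡⟨ cong (λ a → c ℚ.* a ℚ.+ coeff (q *ₚ r) i) (deg-r (suc i) n<1+i) ⟩
    c ℚ.* 0ℚ ℚ.+ coeff (q *ₚ r) i                 ≡⟨ cong (ℚ._+ coeff (q *ₚ r) i) (ℚP.*-zeroʳ c) ⟩
    0ℚ ℚ.+ coeff (q *ₚ r) i                       ≡⟨ ℚP.+-identityˡ (coeff (q *ₚ r) i) ⟩
    coeff (q *ₚ r) i                              ∎
    where open ≡-Reasoning
  degree : DegreeLe ((c ∷ q) *ₚ r) (suc m ℕ.+ n)
  degree (suc i) (s≤s m+n<i) =
    trans (coeff-shift i (ℕP.m<n⇒m<1+n (ℕP.≤-<-trans (ℕP.m≤n+m n m) m+n<i))) (proj₁ ih i m+n<i)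
  leading : coeff ((c ∷ q) *ₚ r) (suc m ℕ.+ n) ≡ coeff q m ℚ.* coeff r n
  leading = trans (coeff-shift (m ℕ.+ n) (s≤s (ℕP.m≤n+m n m))) (proj₂ ih)

-- Stated for deg g ≥ 1: for constant g the leading coefficient formula fails.
∘ₚ-top : ∀ L g m e → DegreeLe L m → DegreeLe g (suc e) →
         DegreeLe (L ∘ₚ g) (m ℕ.* suc e) × (coeff (L ∘ₚ g) (m ℕ.* suc e) ≡ coeff L m ℚ.* qpow (coeff g (suc e)) m)
∘ₚ-top []      g m       e deg-L deg-g = (λ _ _ → refl) , sym (ℚP.*-zeroˡ (qpow (coeff g (suc e)) m))
∘ₚ-top (c ∷ L) g zero    e deg-L deg-g = degree , trans (coeff-c 0) (sym (ℚP.*-identityʳ c))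
  where
  coeff-c : ∀ i → coeff ((c ∷ L) ∘ₚ g) i ≡ coeff (c ∷ []) i
  coeff-c i = trans (coeff-+ₚ (c ∷ []) (g *ₚ (L ∘ₚ g)) i)
    (trans (cong (coeff (c ∷ []) i ℚ.+_) (rest≈0 i)) (ℚP.+-identityʳ (coeff (c ∷ []) i)))
    where
    rest≈0 : IsZero (g *ₚ (L ∘ₚ g))
    rest≈0 = *ₚ-isZeroʳ g (L ∘ₚ g) (∘ₚ-isZero L g (λ j → deg-L (suc j) (s≤s z≤n)))
  degree : DegreeLe ((c ∷ L) ∘ₚ g) 0
  degree (suc i) _ = coeff-c (suc i)
∘ₚ-top (c ∷ L) g (suc m) e deg-L deg-g = degree , leading
  where
  b : ℚ
  b = coeff g (suc e)
  ih : DegreeLe (L ∘ₚ g) (m ℕ.* suc e) × (coeff (L ∘ₚ g) (m ℕ.* suc e) ≡ coeff L m ℚ.* qpow b m)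
  ih = ∘ₚ-top L g m e (λ i m<i → deg-L (suc i) (s≤s m<i)) deg-g
  product : DegreeLe (g *ₚ (L ∘ₚ g)) (suc e ℕ.+ m ℕ.* suc e) ×
            (coeff (g *ₚ (L ∘ₚ g)) (suc e ℕ.+ m ℕ.* suc e) ≡ b ℚ.* coeff (L ∘ₚ g) (m ℕ.* suc e))
  product = *ₚ-top g (L ∘ₚ g) (suc e) (m ℕ.* suc e) deg-g (proj₁ ih)
  coeff-rest : ∀ i → coeff ((c ∷ L) ∘ₚ g) (suc i) ≡ coeff (g *ₚ (L ∘ₚ g)) (suc i)
  coeff-rest i = trans (coeff-+ₚ (c ∷ []) (g *ₚ (L ∘ₚ g)) (suc i)) (ℚP.+-identityˡ _)
  degree : DegreeLe ((c ∷ L) ∘ₚ g) (suc m ℕ.* suc e)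
  degree (suc i) lt = trans (coeff-rest i) (proj₁ product (suc i) lt)
  leading : coeff ((c ∷ L) ∘ₚ g) (suc m ℕ.* suc e) ≡ coeff L m ℚ.* qpow b (suc m)
  leading = begin
    coeff ((c ∷ L) ∘ₚ g) (suc m ℕ.* suc e)             ≡⟨ coeff-rest (e ℕ.+ m ℕ.* suc e) ⟩
    coeff (g *ₚ (L ∘ₚ g)) (suc e ℕ.+ m ℕ.* suc e)      ≡⟨ proj₂ product ⟩
    b ℚ.* coeff (L ∘ₚ g) (m ℕ.* suc e)                 ≡⟨ cong (b ℚ.*_) (proj₂ ih) ⟩
    b ℚ.* (coeff L m ℚ.* qpow b m)                     ≡⟨ ℚ-x∙yz≈y∙xz b (coeff L m) (qpow b m) ⟩
    coeff L m ℚ.* (b ℚ.* qpow b m)                     ∎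
    where open ≡-Reasoning

module Valuation (p : ℕ) (p-prime : Prime p) where

  private
    1<p : 1 ℕ.< p
    1<p = ℕ.nonTrivial⇒n>1 p {{prime⇒nonTrivial p-prime}}

    instance
      p≢0 : ℕ.NonZero p
      p≢0 = ℕ.>-nonZero (ℕP.<-trans (s≤s z≤n) 1<p)

  p^ : ℕ → ℤ
  p^ n = (+ p) ℤ.^ n

  P : ℕ → ℚ
  P = qpow (ι p)

  P≡ιℤ-p^ : ∀ n → P n ≡ ιℤ (p^ n)
  P≡ιℤ-p^ zero    = refl
  P≡ιℤ-p^ (suc n) = trans (cong (ι p ℚ.*_) (P≡ιℤ-p^ n)) (sym (ιℤ-* (+ p) (p^ n)))

  p^≡+ : ∀ n → p^ n ≡ + (p ℕ.^ n)
  p^≡+ zero    = refl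
  p^≡+ (suc n) = trans (cong (+ p ℤ.*_) (p^≡+ n)) (sym (ℤP.pos-* p (p ℕ.^ n)))

  p^≢0 : ∀ n → p^ n ≢ + 0
  p^≢0 n eq = ℕ.≢-nonZero⁻¹ p
    (ℕP.m^n≡0⇒m≡0 p n (ℤP.+-injective (trans (sym (p^≡+ n)) eq)))

  p∤ℕ-* : ∀ {u v} → ¬ (p ℕD.∣ u) → ¬ (p ℕD.∣ v) → ¬ (p ℕD.∣ u ℕ.* v)
  p∤ℕ-* {u} {v} p∤u p∤v p∣uv with euclidsLemma u v p-prime p∣uv
  ... | inj₁ p∣u = p∤u p∣u
  ... | inj₂ p∣v = p∤v p∣v

  p∤⇒≢0 : ∀ {w} → ¬ (p ℕD.∣ w) → w ≢ 0
  p∤⇒≢0 p∤0 refl = p∤0 (p ℕD.∣0)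

  p∤-* : ∀ u v → ¬ (p ℕD.∣ ℤ.∣ u ∣) → ¬ (p ℕD.∣ ℤ.∣ v ∣) → ¬ (p ℕD.∣ ℤ.∣ u ℤ.* v ∣)
  p∤-* u v p∤u p∤v = subst (λ n → ¬ (p ℕD.∣ n)) (sym (ℤP.abs-* u v)) (p∤ℕ-* p∤u p∤v)

  PPowerDecomposition : ℕ → Set
  PPowerDecomposition n = Σ ℕ λ a → Σ ℕ λ m → (n ≡ p ℕ.^ a ℕ.* m) × ¬ (p ℕD.∣ m)

  pPowerDecomposition : ∀ n → n ≢ 0 → PPowerDecomposition n
  pPowerDecomposition = <-rec _ split
    where
    split : ∀ n → (∀ {k} → k ℕ.< n → k ≢ 0 → PPowerDecomposition k) → n ≢ 0 → PPowerDecomposition n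
    split n rec n≢0 with p ℕD.∣? n
    ... | no p∤n = 0 , n , sym (ℕP.+-identityʳ n) , p∤n
    ... | yes (ℕD.divides zero n≡0) = ⊥-elim (n≢0 n≡0)
    ... | yes (ℕD.divides q@(suc _) n≡qp)
      with rec (subst (q ℕ.<_) (sym n≡qp) (ℕP.m<m*n q p 1<p)) (λ ())
    ...   | a , m , q≡ , p∤m = suc a , m , trans n≡qp (trans (cong (ℕ._* p) q≡) (rotate (p ℕ.^ a) m)) , p∤m
      where
      rotate : ∀ x y → x ℕ.* y ℕ.* p ≡ p ℕ.* x ℕ.* y
      rotate x y = trans (ℕP.*-comm (x ℕ.* y) p) (sym (ℕP.*-assoc p x y))

  pPowerDecompositionℤ : ∀ z → z ≢ + 0 → Σ ℕ λ a → Σ ℤ λ u → (z ≡ p^ a ℤ.* u) × ¬ (p ℕD.∣ ℤ.∣ u ∣)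
  pPowerDecompositionℤ (+ n) z≢0 with pPowerDecomposition n (λ n≡0 → z≢0 (cong +_ n≡0))
  ... | a , m , n≡ , p∤m = a , + m , trans (cong +_ n≡) (pos-p^-* a m) , p∤m
    where
    pos-p^-* : ∀ a m → + (p ℕ.^ a ℕ.* m) ≡ p^ a ℤ.* + m
    pos-p^-* a m = trans (ℤP.pos-* (p ℕ.^ a) m) (cong (ℤ._* + m) (sym (p^≡+ a)))
  pPowerDecompositionℤ -[1+ n ] _ with pPowerDecomposition (suc n) (λ ())
  ... | a , m , n≡ , p∤m = a , ℤ.- + m , neg , subst (λ k → ¬ (p ℕD.∣ k)) (sym (ℤP.∣-i∣≡∣i∣ (+ m))) p∤m
    where
    neg : -[1+ n ] ≡ p^ a ℤ.* (ℤ.- + m)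
    neg = begin
      ℤ.- + suc n                       ≡⟨ cong (λ k → ℤ.- + k) n≡ ⟩
      ℤ.- + (p ℕ.^ a ℕ.* m)             ≡⟨ cong ℤ.-_ (ℤP.pos-* (p ℕ.^ a) m) ⟩
      ℤ.- (+ (p ℕ.^ a) ℤ.* + m)         ≡⟨ cong (λ k → ℤ.- (k ℤ.* + m)) (sym (p^≡+ a)) ⟩
      ℤ.- (p^ a ℤ.* + m)                ≡⟨ ℤP.neg-distribʳ-* (p^ a) (+ m) ⟩
      p^ a ℤ.* (ℤ.- + m)                ∎
      where open ≡-Reasoning

  infix 4 ν[_]≡_
  data ν[_]≡_ (x : ℚ) (k : ℤ) : Set where
    mkν : ∀ n m u w → k ≡ + n ℤ.- + m → ¬ (p ℕD.∣ ℤ.∣ u ∣) → ¬ (p ℕD.∣ w) →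
             x ℚ.* ιℤ (p^ m ℤ.* + w) ≡ ιℤ (p^ n ℤ.* u) → ν[ x ]≡ k

  private
    clear-P : ∀ x m w → (x ℚ.* P m) ℚ.* ι (suc w) ≡ x ℚ.* ιℤ (p^ m ℤ.* + suc w)
    clear-P x m w = begin
      (x ℚ.* P m) ℚ.* ι (suc w)            ≡⟨ ℚP.*-assoc x (P m) (ι (suc w)) ⟩
      x ℚ.* (P m ℚ.* ι (suc w))            ≡⟨ cong (λ y → x ℚ.* (y ℚ.* ι (suc w))) (P≡ιℤ-p^ m) ⟩
      x ℚ.* (ιℤ (p^ m) ℚ.* ι (suc w))      ≡⟨ cong (x ℚ.*_) (ιℤ-* (p^ m) (+ suc w)) ⟨
      x ℚ.* ιℤ (p^ m ℤ.* + suc w)          ∎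
      where open ≡-Reasoning

    clear-/ : ∀ n u w → (P n ℚ.* (u / suc w)) ℚ.* ι (suc w) ≡ ιℤ (p^ n ℤ.* u)
    clear-/ n u w = begin
      (P n ℚ.* (u / suc w)) ℚ.* ι (suc w)  ≡⟨ ℚP.*-assoc (P n) (u / suc w) (ι (suc w)) ⟩
      P n ℚ.* ((u / suc w) ℚ.* ι (suc w))  ≡⟨ cong₂ ℚ._*_ (P≡ιℤ-p^ n) (/-*-denominator u w) ⟩
      ιℤ (p^ n) ℚ.* ιℤ u                   ≡⟨ ιℤ-* (p^ n) u ⟨
      ιℤ (p^ n ℤ.* u)                      ∎
      where open ≡-Reasoning

  valIs⇒ν : ∀ {x k} → ValIs p x k → ν[ x ]≡ k
  valIs⇒ν {x} (n , m , u , suc w , _ , k≡ , p∤u , p∤w , eq) =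
    mkν n m u (suc w) k≡ p∤u p∤w
    (trans (sym (clear-P x m w)) (trans (cong (ℚ._* ι (suc w)) eq) (clear-/ n u w)))

  ν⇒valIs : ∀ {x k} → ν[ x ]≡ k → ValIs p x k
  ν⇒valIs (mkν _ _ _ zero _ _ p∤0 _) = ⊥-elim (p∤⇒≢0 p∤0 refl)
  ν⇒valIs {x} (mkν n m u (suc w) k≡ p∤u p∤w eq) =
    n , m , u , suc w , _ , k≡ , p∤u , p∤w ,
    *-cancelʳ-≢0 _ _ (ι (suc w))
      (trans (clear-P x m w) (trans eq (sym (clear-/ n u w))))
      (λ w≡0 → ℕP.1+n≢0 (ℤP.+-injective (ιℤ≡0⇒≡0 (+ suc w) w≡0)))

  ν⇒≢0 : ∀ {x k} → ν[ x ]≡ k → x ≢ 0ℚ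
  ν⇒≢0 (mkν n m u w _ p∤u _ eq) refl
    with ℤP.i*j≡0⇒i≡0∨j≡0 (p^ n) (ιℤ≡0⇒≡0 _ (trans (sym eq) (ℚP.*-zeroˡ (ιℤ (p^ m ℤ.* + w)))))
  ... | inj₁ p^n≡0 = p^≢0 n p^n≡0
  ... | inj₂ refl  = p∤⇒≢0 p∤u refl

  private
    p^-*-split : ∀ n n' u u' → p^ (n ℕ.+ n') ℤ.* (u ℤ.* u') ≡ (p^ n ℤ.* u) ℤ.* (p^ n' ℤ.* u')
    p^-*-split n n' u u' =
      trans (cong (ℤ._* (u ℤ.* u')) (ℤP.^-distribˡ-+-* (+ p) n n')) (ℤ-interchange (p^ n) (p^ n') u u')

    den-split : ∀ m m' w w' → p^ (m ℕ.+ m') ℤ.* + (w ℕ.* w') ≡ (p^ m ℤ.* + w) ℤ.* (p^ m' ℤ.* + w')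
    den-split m m' w w' = trans (cong (p^ (m ℕ.+ m') ℤ.*_) (ℤP.pos-* w w')) (p^-*-split m m' (+ w) (+ w'))

    exponent-+ : ∀ n m n' m' → (+ n ℤ.- + m) ℤ.+ (+ n' ℤ.- + m') ≡ + (n ℕ.+ n') ℤ.- + (m ℕ.+ m')
    exponent-+ n m n' m' =
      trans (regroup (+ n) (+ m) (+ n') (+ m')) (sym (cong₂ ℤ._-_ (ℤP.pos-+ n n') (ℤP.pos-+ m m')))
      where
      regroup : ∀ a b c d → (a ℤ.- b) ℤ.+ (c ℤ.- d) ≡ (a ℤ.+ c) ℤ.- (b ℤ.+ d)
      regroup = solve-∀

    ιℤ-den≢0 : ∀ m w → ¬ (p ℕD.∣ w) → ιℤ (p^ m ℤ.* + w) ≢ 0ℚ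
    ιℤ-den≢0 m w p∤w eq with ℤP.i*j≡0⇒i≡0∨j≡0 (p^ m) (ιℤ≡0⇒≡0 _ eq)
    ... | inj₁ p^m≡0 = p^≢0 m p^m≡0
    ... | inj₂ w≡0   = p∤⇒≢0 p∤w (ℤP.+-injective w≡0)

  ν-* : ∀ {x y j k} → ν[ x ]≡ j → ν[ y ]≡ k → ν[ x ℚ.* y ]≡ j ℤ.+ k
  ν-* {x} {y} (mkν n m u w refl p∤u p∤w eq) (mkν n' m' u' w' refl p∤u' p∤w' eq') =
    mkν (n ℕ.+ n') (m ℕ.+ m') (u ℤ.* u') (w ℕ.* w') (exponent-+ n m n' m')
      (p∤-* u u' p∤u p∤u') (p∤ℕ-* p∤w p∤w') product
    where
    A A' : ℤ
    A = p^ m ℤ.* + w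
    A' = p^ m' ℤ.* + w'
    product : (x ℚ.* y) ℚ.* ιℤ (p^ (m ℕ.+ m') ℤ.* + (w ℕ.* w')) ≡ ιℤ (p^ (n ℕ.+ n') ℤ.* (u ℤ.* u'))
    product = begin
      (x ℚ.* y) ℚ.* ιℤ (p^ (m ℕ.+ m') ℤ.* + (w ℕ.* w'))
        ≡⟨ cong (λ z → (x ℚ.* y) ℚ.* ιℤ z) (den-split m m' w w') ⟩
      (x ℚ.* y) ℚ.* ιℤ (A ℤ.* A')                   ≡⟨ cong ((x ℚ.* y) ℚ.*_) (ιℤ-* A A') ⟩
      (x ℚ.* y) ℚ.* (ιℤ A ℚ.* ιℤ A')                ≡⟨ ℚ-interchange x y (ιℤ A) (ιℤ A') ⟩
      (x ℚ.* ιℤ A) ℚ.* (y ℚ.* ιℤ A')                ≡⟨ cong₂ ℚ._*_ eq eq' ⟩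
      ιℤ (p^ n ℤ.* u) ℚ.* ιℤ (p^ n' ℤ.* u')         ≡⟨ ιℤ-* (p^ n ℤ.* u) (p^ n' ℤ.* u') ⟨
      ιℤ ((p^ n ℤ.* u) ℤ.* (p^ n' ℤ.* u'))          ≡⟨ cong ιℤ (p^-*-split n n' u u') ⟨
      ιℤ (p^ (n ℕ.+ n') ℤ.* (u ℤ.* u'))             ∎
      where open ≡-Reasoning

  private
    common-factor : ∀ a b a' b' e u w u' w' → a' ℤ.* b ≡ a ℤ.* b' ℤ.* e →
      (a ℤ.* u) ℤ.* (b' ℤ.* w') ℤ.+ (a' ℤ.* u') ℤ.* (b ℤ.* w) ≡ (a ℤ.* b') ℤ.* (u ℤ.* w' ℤ.+ e ℤ.* u' ℤ.* w)
    common-factor a b a' b' e u w u' w' h = trans (regroup a b a' b' u w u' w')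
      (trans (cong (λ t → (a ℤ.* u) ℤ.* (b' ℤ.* w') ℤ.+ t ℤ.* (u' ℤ.* w)) h) (collect a b' e u w u' w'))
      where
      regroup : ∀ a b a' b' u w u' w' → (a ℤ.* u) ℤ.* (b' ℤ.* w') ℤ.+ (a' ℤ.* u') ℤ.* (b ℤ.* w) ≡
                                         (a ℤ.* u) ℤ.* (b' ℤ.* w') ℤ.+ (a' ℤ.* b) ℤ.* (u' ℤ.* w)
      regroup = solve-∀
      collect : ∀ a b' e u w u' w' → (a ℤ.* u) ℤ.* (b' ℤ.* w') ℤ.+ (a ℤ.* b' ℤ.* e) ℤ.* (u' ℤ.* w) ≡
                                      (a ℤ.* b') ℤ.* (u ℤ.* w' ℤ.+ e ℤ.* u' ℤ.* w)
      collect = solve-∀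

  -- δ is the gap between the two valuations.
  +-common-denominator : ∀ {x y} n m u w n' m' u' w' δ →
    x ℚ.* ιℤ (p^ m ℤ.* + w) ≡ ιℤ (p^ n ℤ.* u) →
    y ℚ.* ιℤ (p^ m' ℤ.* + w') ≡ ιℤ (p^ n' ℤ.* u') →
    n' ℕ.+ m ≡ (n ℕ.+ m') ℕ.+ δ →
    (x ℚ.+ y) ℚ.* ιℤ (p^ (m ℕ.+ m') ℤ.* + (w ℕ.* w')) ≡
      ιℤ (p^ (n ℕ.+ m') ℤ.* (u ℤ.* + w' ℤ.+ p^ δ ℤ.* u' ℤ.* + w))
  +-common-denominator {x} {y} n m u w n' m' u' w' δ eq eq' gap = begin
    (x ℚ.+ y) ℚ.* ιℤ (p^ (m ℕ.+ m') ℤ.* + (w ℕ.* w'))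
      ≡⟨ cong (λ z → (x ℚ.+ y) ℚ.* z) (trans (cong ιℤ (den-split m m' w w')) (ιℤ-* A A')) ⟩
    (x ℚ.+ y) ℚ.* (ιℤ A ℚ.* ιℤ A')
      ≡⟨ distribute x y (ιℤ A) (ιℤ A') ⟩
    (x ℚ.* ιℤ A) ℚ.* ιℤ A' ℚ.+ (y ℚ.* ιℤ A') ℚ.* ιℤ A
      ≡⟨ cong₂ (λ s t → s ℚ.* ιℤ A' ℚ.+ t ℚ.* ιℤ A) eq eq' ⟩
    ιℤ B ℚ.* ιℤ A' ℚ.+ ιℤ B' ℚ.* ιℤ A
      ≡⟨ cong₂ ℚ._+_ (ιℤ-* B A') (ιℤ-* B' A) ⟨
    ιℤ (B ℤ.* A') ℚ.+ ιℤ (B' ℤ.* A)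
      ≡⟨ ιℤ-+ (B ℤ.* A') (B' ℤ.* A) ⟨
    ιℤ (B ℤ.* A' ℤ.+ B' ℤ.* A)
      ≡⟨ cong ιℤ (common-factor (p^ n) (p^ m) (p^ n') (p^ m') (p^ δ) u (+ w) u' (+ w') p^-gap) ⟩
    ιℤ ((p^ n ℤ.* p^ m') ℤ.* (u ℤ.* + w' ℤ.+ p^ δ ℤ.* u' ℤ.* + w))
      ≡⟨ cong (λ z → ιℤ (z ℤ.* (u ℤ.* + w' ℤ.+ p^ δ ℤ.* u' ℤ.* + w))) (ℤP.^-distribˡ-+-* (+ p) n m') ⟨
    ιℤ (p^ (n ℕ.+ m') ℤ.* (u ℤ.* + w' ℤ.+ p^ δ ℤ.* u' ℤ.* + w)) ∎
    where
    open ≡-Reasoning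
    A A' B B' : ℤ
    A = p^ m ℤ.* + w
    A' = p^ m' ℤ.* + w'
    B = p^ n ℤ.* u
    B' = p^ n' ℤ.* u'
    distribute : ∀ x y a a' → (x ℚ.+ y) ℚ.* (a ℚ.* a') ≡ (x ℚ.* a) ℚ.* a' ℚ.+ (y ℚ.* a') ℚ.* a
    distribute = solve 4 (λ x y a a' → (x :+ y) :* (a :* a') := (x :* a) :* a' :+ (y :* a') :* a) refl
      where open +-*-Solver
    p^-gap : p^ n' ℤ.* p^ m ≡ p^ n ℤ.* p^ m' ℤ.* p^ δ
    p^-gap = begin
      p^ n' ℤ.* p^ m             ≡⟨ ℤP.^-distribˡ-+-* (+ p) n' m ⟨
      p^ (n' ℕ.+ m)              ≡⟨ cong p^ gap ⟩
      p^ (n ℕ.+ m' ℕ.+ δ)        ≡⟨ ℤP.^-distribˡ-+-* (+ p) (n ℕ.+ m') δ ⟩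
      p^ (n ℕ.+ m') ℤ.* p^ δ     ≡⟨ cong (ℤ._* p^ δ) (ℤP.^-distribˡ-+-* (+ p) n m') ⟩
      p^ n ℤ.* p^ m' ℤ.* p^ δ    ∎
  private
    cross : ∀ n m n' m' → (+ n ℤ.- + m) ℤ.+ (+ m ℤ.+ + m') ≡ + (n ℕ.+ m') ×
                          (+ n' ℤ.- + m') ℤ.+ (+ m ℤ.+ + m') ≡ + (n' ℕ.+ m)
    cross n m n' m' = trans (cancel₁ (+ n) (+ m) (+ m')) (sym (ℤP.pos-+ n m')) ,
                      trans (cancel₂ (+ n') (+ m') (+ m)) (sym (ℤP.pos-+ n' m))
      where
      cancel₁ : ∀ a b c → (a ℤ.- b) ℤ.+ (b ℤ.+ c) ≡ a ℤ.+ c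
      cancel₁ = solve-∀
      cancel₂ : ∀ a b c → (a ℤ.- b) ℤ.+ (c ℤ.+ b) ≡ a ℤ.+ c
      cancel₂ = solve-∀

    cross-≤ : ∀ n m n' m' → + n ℤ.- + m ℤ.≤ + n' ℤ.- + m' → n ℕ.+ m' ℕ.≤ n' ℕ.+ m
    cross-≤ n m n' m' le with cross n m n' m'
    ... | l , r = ℤP.drop‿+≤+ (subst₂ ℤ._≤_ l r (ℤP.+-monoˡ-≤ (+ m ℤ.+ + m') le))

    cross-< : ∀ n m n' m' → + n ℤ.- + m ℤ.< + n' ℤ.- + m' → n ℕ.+ m' ℕ.< n' ℕ.+ m
    cross-< n m n' m' lt with cross n m n' m'
    ... | l , r = ℤP.drop‿+<+ (subst₂ ℤ._<_ l r (ℤP.+-monoˡ-< (+ m ℤ.+ + m') lt))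

    exponent-shift : ∀ n m c → + n ℤ.- + m ≡ + (n ℕ.+ c) ℤ.- + (m ℕ.+ c)
    exponent-shift n m c =
      sym (trans (cong₂ ℤ._-_ (ℤP.pos-+ n c) (ℤP.pos-+ m c)) (cancel (+ n) (+ m) (+ c)))
      where
      cancel : ∀ a b c → (a ℤ.+ c) ℤ.- (b ℤ.+ c) ≡ a ℤ.- b
      cancel = solve-∀

  ν-+-≤ : ∀ {x y j k} → ν[ x ]≡ j → ν[ y ]≡ k → j ℤ.≤ k →
               (x ℚ.+ y ≡ 0ℚ) ⊎ Σ ℤ λ l → ν[ x ℚ.+ y ]≡ l × j ℤ.≤ l
  ν-+-≤ {x} {y} (mkν n m u w refl p∤u p∤w eq) (mkν n' m' u' w' refl _ p∤w' eq') j≤k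
    with ℕP.m≤n⇒∃[o]m+o≡n (cross-≤ n m n' m' j≤k)
  ... | δ , gap with ℤP._≟_ (u ℤ.* + w' ℤ.+ p^ δ ℤ.* u' ℤ.* + w) (+ 0)
  ...   | yes numerator≡0 = inj₁ (*-cancelʳ-≢0 _ _ _ sum≡0 (ιℤ-den≢0 (m ℕ.+ m') (w ℕ.* w') (p∤ℕ-* p∤w p∤w')))
    where
    sum≡0 : (x ℚ.+ y) ℚ.* ιℤ (p^ (m ℕ.+ m') ℤ.* + (w ℕ.* w')) ≡ 0ℚ ℚ.* ιℤ (p^ (m ℕ.+ m') ℤ.* + (w ℕ.* w'))
    sum≡0 = trans (+-common-denominator {x} {y} n m u w n' m' u' w' δ eq eq' (sym gap))
      (trans (cong (λ z → ιℤ (p^ (n ℕ.+ m') ℤ.* z)) numerator≡0)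
      (trans (cong ιℤ (ℤP.*-zeroʳ (p^ (n ℕ.+ m')))) (sym (ℚP.*-zeroˡ (ιℤ (p^ (m ℕ.+ m') ℤ.* + (w ℕ.* w')))))))
  ...   | no numerator≢0 with pPowerDecompositionℤ _ numerator≢0
  ...     | a , v , numerator≡ , p∤v =
    inj₂ (_ , mkν (n ℕ.+ m' ℕ.+ a) (m ℕ.+ m') v (w ℕ.* w') refl p∤v (p∤ℕ-* p∤w p∤w') sum , j≤l)
    where
    sum : (x ℚ.+ y) ℚ.* ιℤ (p^ (m ℕ.+ m') ℤ.* + (w ℕ.* w')) ≡ ιℤ (p^ (n ℕ.+ m' ℕ.+ a) ℤ.* v)
    sum = trans (+-common-denominator {x} {y} n m u w n' m' u' w' δ eq eq' (sym gap))
      (cong ιℤ (trans (cong (p^ (n ℕ.+ m') ℤ.*_) numerator≡)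
      (trans (sym (ℤP.*-assoc (p^ (n ℕ.+ m')) (p^ a) v))
      (cong (ℤ._* v) (sym (ℤP.^-distribˡ-+-* (+ p) (n ℕ.+ m') a))))))
    j≤l : + n ℤ.- + m ℤ.≤ + (n ℕ.+ m' ℕ.+ a) ℤ.- + (m ℕ.+ m')
    j≤l = subst (+ n ℤ.- + m ℤ.≤_) (sym l≡) (ℤP.i≤i+j (+ n ℤ.- + m) (+ a))
      where
      regroup : ∀ a b c → (a ℤ.+ c) ℤ.- b ≡ (a ℤ.- b) ℤ.+ c
      regroup = solve-∀
      l≡ : + (n ℕ.+ m' ℕ.+ a) ℤ.- + (m ℕ.+ m') ≡ (+ n ℤ.- + m) ℤ.+ + a
      l≡ = trans (cong (ℤ._- + (m ℕ.+ m')) (ℤP.pos-+ (n ℕ.+ m') a))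
           (trans (regroup (+ (n ℕ.+ m')) (+ (m ℕ.+ m')) (+ a))
                  (cong (ℤ._+ + a) (sym (exponent-shift n m m'))))

  -- When the valuations differ, p divides the second summand u' w p^δ of the numerator but not the first.
  ν-+-< : ∀ {x y j k} → ν[ x ]≡ j → ν[ y ]≡ k → j ℤ.< k → ν[ x ℚ.+ y ]≡ j
  ν-+-< {x} {y} (mkν n m u w refl p∤u p∤w eq) (mkν n' m' u' w' refl _ p∤w' eq') j<k
    with ℕP.m≤n⇒∃[o]m+o≡n (cross-< n m n' m' j<k)
  ... | o , gap =
    mkν (n ℕ.+ m') (m ℕ.+ m') numerator (w ℕ.* w') (exponent-shift n m m') p∤numerator (p∤ℕ-* p∤w p∤w')
    (+-common-denominator {x} {y} n m u w n' m' u' w' (suc o) eq eq' (sym (trans (ℕP.+-suc (n ℕ.+ m') o) gap)))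
    where
    numerator : ℤ
    numerator = u ℤ.* + w' ℤ.+ p^ (suc o) ℤ.* u' ℤ.* + w
    p∣second : + p ℤS.∣ p^ (suc o) ℤ.* u' ℤ.* + w
    p∣second = ℤS.∣m⇒∣m*n (+ w) (ℤS.∣m⇒∣m*n u' (ℤS.∣m⇒∣m*n (p^ o) ℤS.∣-refl))
    p∤numerator : ¬ (p ℕD.∣ ℤ.∣ numerator ∣)
    p∤numerator p∣ = p∤-* u (+ w') p∤u p∤w'
      (ℤS.∣⇒∣ᵤ (ℤS.∣m+n∣n⇒∣m {+ p} {u ℤ.* + w'} (ℤS.∣ᵤ⇒∣ p∣) p∣second))

  ν-+ : ∀ {x y j k} → ν[ x ]≡ j → ν[ y ]≡ k →
        (x ℚ.+ y ≡ 0ℚ) ⊎ Σ ℤ λ l → ν[ x ℚ.+ y ]≡ l × (j ℤ.≤ l ⊎ k ℤ.≤ l)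
  ν-+ {j = j} {k} νx νy with ℤP.≤-total j k
  ... | inj₁ j≤k with ν-+-≤ νx νy j≤k
  ...   | inj₁ x+y≡0            = inj₁ x+y≡0
  ...   | inj₂ (l , νx+y , j≤l) = inj₂ (l , νx+y , inj₁ j≤l)
  ν-+ {x} {y} νx νy | inj₂ k≤j with ν-+-≤ νy νx k≤j
  ...   | inj₁ y+x≡0            = inj₁ (trans (ℚP.+-comm x y) y+x≡0)
  ...   | inj₂ (l , νy+x , k≤l) = inj₂ (l , subst (ν[_]≡ l) (ℚP.+-comm y x) νy+x , inj₂ k≤l)

  private
    p∤1 : ¬ (p ℕD.∣ 1)
    p∤1 p∣1 = ℕP.<⇒≢ 1<p (sym (ℕD.∣1⇒≡1 p∣1))

  ν-1 : ν[ 1ℚ ]≡ + 0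
  ν-1 = mkν 0 0 (+ 1) 1 refl p∤1 p∤1 refl

  ν-p : ν[ ι p ]≡ + 1
  ν-p = valIs⇒ν (1 , 0 , + 1 , 1 , _ , refl , p∤1 , p∤1 , sym (ℚP.*-identityʳ (ι p ℚ.* 1ℚ)))

  ν-qpow : ∀ {b k} → ν[ b ]≡ k → ∀ m → ν[ qpow b m ]≡ + m ℤ.* k
  ν-qpow νb zero          = ν-1
  ν-qpow {k = k} νb (suc m) = subst (ν[ _ ]≡_) (exponent m) (ν-* νb (ν-qpow νb m))
    where
    exponent : ∀ m → k ℤ.+ + m ℤ.* k ≡ + suc m ℤ.* k
    exponent m = sym (begin
      + suc m ℤ.* k               ≡⟨ cong (ℤ._* k) (ℤP.pos-+ 1 m) ⟩
      (+ 1 ℤ.+ + m) ℤ.* k         ≡⟨ ℤP.*-distribʳ-+ k (+ 1) (+ m) ⟩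
      + 1 ℤ.* k ℤ.+ + m ℤ.* k     ≡⟨ cong (ℤ._+ + m ℤ.* k) (ℤP.*-identityˡ k) ⟩
      k ℤ.+ + m ℤ.* k             ∎)
      where open ≡-Reasoning

  ν-P : ∀ s → ν[ P s ]≡ + s
  ν-P s = subst (ν[ P s ]≡_) (ℤP.*-identityʳ (+ s)) (ν-qpow ν-p s)

module NewtonLine (p : ℕ) (p-prime : Prime p) where
  open Valuation p p-prime

  data Above (a B : ℕ) (t : ℤ) (x : ℚ) (i : ℕ) : Set where
    vanishes   : x ≡ 0ℚ → Above a B t x i
    lies-above : ∀ {v} → ν[ x ]≡ v → t ℤ.≤ + a ℤ.* v ℤ.+ + (i ℕ.* B) → Above a B t x i

  PolyAbove : ℕ → ℕ → ℤ → Poly → Set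
  PolyAbove a B t q = ∀ i → Above a B t (coeff q i) i

  Above-resp-≡ : ∀ {a B t t' x i} → t ≡ t' → Above a B t x i → Above a B t' x i
  Above-resp-≡ refl above = above

  private
    raise-val : ∀ a c {j l} → j ℤ.≤ l → + a ℤ.* j ℤ.+ c ℤ.≤ + a ℤ.* l ℤ.+ c
    raise-val a c j≤l = ℤP.+-monoˡ-≤ c (ℤP.*-monoˡ-≤-nonNeg (+ a) j≤l)

  Above-+ : ∀ {a B t x y i} → Above a B t x i → Above a B t y i → Above a B t (x ℚ.+ y) i
  Above-+ {a} {B} {t} {i = i} (vanishes refl) y-above =
    subst (λ z → Above a B t z i) (sym (ℚP.+-identityˡ _)) y-above
  Above-+ {a} {B} {t} {i = i} x-above (vanishes refl) =
    subst (λ z → Above a B t z i) (sym (ℚP.+-identityʳ _)) x-above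
  Above-+ {a} (lies-above νx tx) (lies-above νy ty) with ν-+ νx νy
  ... | inj₁ x+y≡0                 = vanishes x+y≡0
  ... | inj₂ (l , νx+y , inj₁ j≤l) = lies-above νx+y (ℤP.≤-trans tx (raise-val a _ j≤l))
  ... | inj₂ (l , νx+y , inj₂ k≤l) = lies-above νx+y (ℤP.≤-trans ty (raise-val a _ k≤l))

  Above-* : ∀ {a B t₁ t₂ x y i} → Above a B t₁ x 0 → Above a B t₂ y i → Above a B (t₁ ℤ.+ t₂) (x ℚ.* y) i
  Above-* {y = y} (vanishes refl) _                = vanishes (ℚP.*-zeroˡ y)
  Above-* {x = x} (lies-above _ _) (vanishes refl) = vanishes (ℚP.*-zeroʳ x)
  Above-* {a} {B} {i = i} (lies-above {j} νx tx) (lies-above {k} νy ty) =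
    lies-above (ν-* νx νy) (ℤP.≤-trans (ℤP.+-mono-≤ tx ty) (ℤP.≤-reflexive (collect (+ a) j k (+ (i ℕ.* B)))))
    where
    collect : ∀ A j k C → (A ℤ.* j ℤ.+ + 0) ℤ.+ (A ℤ.* k ℤ.+ C) ≡ A ℤ.* (j ℤ.+ k) ℤ.+ C
    collect = solve-∀

  Above-0 : ∀ {a B B' t x} → Above a B t x 0 → Above a B' t x 0
  Above-0 (vanishes x≡0)     = vanishes x≡0
  Above-0 (lies-above νx tx) = lies-above νx tx

  Above-suc⁻ : ∀ {a B t x i} → Above a B t x (suc i) → Above a B (t ℤ.- + B) x i
  Above-suc⁻ (vanishes x≡0) = vanishes x≡0
  Above-suc⁻ {a} {B} {t} {i = i} (lies-above {v} νx tx) = lies-above νx (begin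
    t ℤ.- + B                                        ≤⟨ ℤP.+-monoˡ-≤ (ℤ.- + B) tx ⟩
    + a ℤ.* v ℤ.+ + (B ℕ.+ i ℕ.* B) ℤ.- + B          ≡⟨ cong (λ c → + a ℤ.* v ℤ.+ c ℤ.- + B) (ℤP.pos-+ B (i ℕ.* B)) ⟩
    + a ℤ.* v ℤ.+ (+ B ℤ.+ + (i ℕ.* B)) ℤ.- + B      ≡⟨ cancel (+ a ℤ.* v) (+ B) (+ (i ℕ.* B)) ⟩
    + a ℤ.* v ℤ.+ + (i ℕ.* B)                        ∎)
    where
    open ℤP.≤-Reasoning
    cancel : ∀ X b c → X ℤ.+ (b ℤ.+ c) ℤ.- b ≡ X ℤ.+ c
    cancel = solve-∀

  Above-suc : ∀ {a B t x i} → Above a B t x i → Above a B (t ℤ.+ + B) x (suc i)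
  Above-suc (vanishes x≡0) = vanishes x≡0
  Above-suc {a} {B} {t} {i = i} (lies-above {v} νx tx) = lies-above νx (begin
    t ℤ.+ + B                                        ≤⟨ ℤP.+-monoˡ-≤ (+ B) tx ⟩
    + a ℤ.* v ℤ.+ + (i ℕ.* B) ℤ.+ + B                ≡⟨ regroup (+ a ℤ.* v) (+ B) (+ (i ℕ.* B)) ⟩
    + a ℤ.* v ℤ.+ (+ B ℤ.+ + (i ℕ.* B))              ≡⟨ cong (λ c → + a ℤ.* v ℤ.+ c) (ℤP.pos-+ B (i ℕ.* B)) ⟨
    + a ℤ.* v ℤ.+ + (B ℕ.+ i ℕ.* B)                  ∎)
    where
    open ℤP.≤-Reasoning
    regroup : ∀ X b c → X ℤ.+ c ℤ.+ b ≡ X ℤ.+ (b ℤ.+ c)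
    regroup = solve-∀

  Above-mono-B : ∀ {a B B' t x i} → B ℕ.≤ B' → Above a B t x i → Above a B' t x i
  Above-mono-B B≤B' (vanishes x≡0) = vanishes x≡0
  Above-mono-B {a} {i = i} B≤B' (lies-above {v} νx tx) =
    lies-above νx (ℤP.≤-trans tx (ℤP.+-monoʳ-≤ (+ a ℤ.* v) (ℤ.+≤+ (ℕP.*-monoʳ-≤ i B≤B'))))

  Above-scale : ∀ {a B t x i} e → Above a B t x i → Above (a ℕ.* e) (B ℕ.* e) (t ℤ.* + e) x i
  Above-scale e (vanishes x≡0) = vanishes x≡0
  Above-scale {a} {B} {t} {i = i} e (lies-above {v} νx tx) = lies-above νx (begin
    t ℤ.* + e                                  ≤⟨ ℤP.*-monoʳ-≤-nonNeg (+ e) tx ⟩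
    (+ a ℤ.* v ℤ.+ + (i ℕ.* B)) ℤ.* + e        ≡⟨ cong (λ c → (+ a ℤ.* v ℤ.+ c) ℤ.* + e) (ℤP.pos-* i B) ⟩
    (+ a ℤ.* v ℤ.+ + i ℤ.* + B) ℤ.* + e        ≡⟨ distrib (+ a) v (+ i) (+ B) (+ e) ⟩
    (+ a ℤ.* + e) ℤ.* v ℤ.+ + i ℤ.* (+ B ℤ.* + e)
      ≡⟨ cong₂ (λ ae Be → ae ℤ.* v ℤ.+ + i ℤ.* Be) (ℤP.pos-* a e) (ℤP.pos-* B e) ⟨
    + (a ℕ.* e) ℤ.* v ℤ.+ + i ℤ.* + (B ℕ.* e)  ≡⟨ cong (λ c → + (a ℕ.* e) ℤ.* v ℤ.+ c) (ℤP.pos-* i (B ℕ.* e)) ⟨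
    + (a ℕ.* e) ℤ.* v ℤ.+ + (i ℕ.* (B ℕ.* e))  ∎)
    where
    open ℤP.≤-Reasoning
    distrib : ∀ a v i B e → (a ℤ.* v ℤ.+ i ℤ.* B) ℤ.* e ≡ (a ℤ.* e) ℤ.* v ℤ.+ i ℤ.* (B ℤ.* e)
    distrib = solve-∀

  PolyAbove-+ₚ : ∀ {a B t} q r → PolyAbove a B t q → PolyAbove a B t r → PolyAbove a B t (q +ₚ r)
  PolyAbove-+ₚ {a} {B} {t} q r q-above r-above i =
    subst (λ z → Above a B t z i) (sym (coeff-+ₚ q r i)) (Above-+ (q-above i) (r-above i))

  PolyAbove-*ₚ : ∀ {a B t₁ t₂} q r → PolyAbove a B t₁ q → PolyAbove a B t₂ r → PolyAbove a B (t₁ ℤ.+ t₂) (q *ₚ r)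
  PolyAbove-*ₚ []      r q-above r-above i = vanishes refl
  PolyAbove-*ₚ {a} {B} {t₁} {t₂} (c ∷ q) r q-above r-above =
    PolyAbove-+ₚ (scale c r) (shiftX (q *ₚ r)) scaled shifted
    where
    scaled : PolyAbove a B (t₁ ℤ.+ t₂) (scale c r)
    scaled i = subst (λ z → Above a B (t₁ ℤ.+ t₂) z i) (sym (coeff-scale c r i)) (Above-* (q-above 0) (r-above i))
    tail-product : PolyAbove a B ((t₁ ℤ.- + B) ℤ.+ t₂) (q *ₚ r)
    tail-product = PolyAbove-*ₚ q r (λ i → Above-suc⁻ (q-above (suc i))) r-above
    shifted : PolyAbove a B (t₁ ℤ.+ t₂) (shiftX (q *ₚ r))
    shifted zero    = vanishes refl
    shifted (suc i) = Above-resp-≡ (cancel t₁ (+ B) t₂) (Above-suc (tail-product i))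
      where
      cancel : ∀ t b s → t ℤ.- b ℤ.+ s ℤ.+ b ≡ t ℤ.+ s
      cancel = solve-∀

  PolyAbove-∘ₚ : ∀ {a B G T} L g → PolyAbove a G T L → PolyAbove a B (+ G) g → PolyAbove a B T (L ∘ₚ g)
  PolyAbove-∘ₚ []      g L-above g-above i = vanishes refl
  PolyAbove-∘ₚ {a} {B} {G} {T} (c ∷ L) g L-above g-above =
    PolyAbove-+ₚ (c ∷ []) (g *ₚ (L ∘ₚ g)) constant
      (λ i → Above-resp-≡ (cancel (+ G) T) (PolyAbove-*ₚ g (L ∘ₚ g) g-above tail-composite i))
    where
    constant : PolyAbove a B T (c ∷ [])
    constant zero    = Above-0 (L-above 0)
    constant (suc i) = vanishes refl
    tail-composite : PolyAbove a B (T ℤ.- + G) (L ∘ₚ g)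
    tail-composite = PolyAbove-∘ₚ L g (λ i → Above-suc⁻ (L-above (suc i))) g-above
    cancel : ∀ g t → g ℤ.+ (t ℤ.- g) ≡ t
    cancel = solve-∀

  PolyAbove-monomial : ∀ {a B t b} e → ν[ b ]≡ + 0 → t ℤ.≤ + (e ℕ.* B) → PolyAbove a B t (monomial b e)
  PolyAbove-monomial {a} {B} {t} {b} e νb t≤ i with i ℕ.≟ e
  ... | yes refl = lies-above (subst (ν[_]≡ + 0) (sym (coeff-monomial-≡ b e)) νb)
                     (subst (λ z → t ℤ.≤ z ℤ.+ + (e ℕ.* B)) (sym (ℤP.*-zeroʳ (+ a))) t≤)
  ... | no i≢e   = vanishes (coeff-monomial-≢ b e i i≢e)

  PolyAbove-scale-P : ∀ {a B t} s h → PolyValGe p (+ 0) h → t ℤ.≤ + a ℤ.* + s → PolyAbove a B t (scale (P s) h)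
  PolyAbove-scale-P {a} {B} {t} s h h-integral t≤ i with h-integral i
  ... | inj₁ hᵢ≡0 =
    vanishes (trans (coeff-scale (P s) h i) (trans (cong (P s ℚ.*_) hᵢ≡0) (ℚP.*-zeroʳ (P s))))
  ... | inj₂ (v , valIs-hᵢ , 0≤v) =
    lies-above (subst (ν[_]≡ + s ℤ.+ v) (sym (coeff-scale (P s) h i)) (ν-* (ν-P s) (valIs⇒ν {coeff h i} valIs-hᵢ)))
      (begin
        t                                       ≤⟨ t≤ ⟩
        + a ℤ.* + s                             ≤⟨ ℤP.*-monoˡ-≤-nonNeg (+ a) (ℤP.i≤i+j (+ s) v {{ℤ.nonNegative 0≤v}}) ⟩
        + a ℤ.* (+ s ℤ.+ v)                     ≤⟨ ℤP.i≤i+j (+ a ℤ.* (+ s ℤ.+ v)) (+ (i ℕ.* B)) ⟩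
        + a ℤ.* (+ s ℤ.+ v) ℤ.+ + (i ℕ.* B)     ∎)
    where open ℤP.≤-Reasoning

HasDegree-unique : ∀ {q m n} → HasDegree q m → HasDegree q n → m ≡ n
HasDegree-unique {m = m} {n} (qₘ≢0 , above-m) (qₙ≢0 , above-n) with ℕP.<-cmp m n
... | tri< m<n _ _ = ⊥-elim (qₙ≢0 (above-m n m<n))
... | tri≈ _ m≡n _ = m≡n
... | tri> _ _ n<m = ⊥-elim (qₘ≢0 (above-n m n<m))

private
  line-split : ∀ r {n i} → i ≤ n → + (r * (n ∸ i)) ℤ.+ + (i * r) ≡ + (n * r)
  line-split r {n} {i} i≤n = begin
    + (r * (n ∸ i)) ℤ.+ + (i * r)   ≡⟨ ℤP.pos-+ (r * (n ∸ i)) (i * r) ⟨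
    + (r * (n ∸ i) ℕ.+ i * r)       ≡⟨ cong (λ k → + (r * (n ∸ i) ℕ.+ k)) (ℕP.*-comm i r) ⟩
    + (r * (n ∸ i) ℕ.+ r * i)       ≡⟨ cong +_ (ℕP.*-distribˡ-+ r (n ∸ i) i) ⟨
    + (r * (n ∸ i ℕ.+ i))           ≡⟨ cong (λ k → + (r * k)) (ℕP.m∸n+n≡m i≤n) ⟩
    + (r * n)                       ≡⟨ cong +_ (ℕP.*-comm r n) ⟩
    + (n * r)                       ∎
    where open ≡-Reasoning

line⇒above : ∀ r n i v → i ≤ n → + (r * (n ∸ i)) ℤ.≤ + n ℤ.* v → + (n * r) ℤ.≤ + n ℤ.* v ℤ.+ + (i * r)
line⇒above r n i v i≤n le =
  subst (ℤ._≤ + n ℤ.* v ℤ.+ + (i * r)) (line-split r i≤n) (ℤP.+-monoˡ-≤ (+ (i * r)) le)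

above⇒line : ∀ r n i v → i ≤ n → + (n * r) ℤ.≤ + n ℤ.* v ℤ.+ + (i * r) → + (r * (n ∸ i)) ℤ.≤ + n ℤ.* v
above⇒line r n i v i≤n le = subst₂ ℤ._≤_ (cancel (+ (r * (n ∸ i))) (+ (i * r))) (cancel (+ n ℤ.* v) (+ (i * r)))
  (ℤP.+-monoˡ-≤ (ℤ.- + (i * r)) (subst (ℤ._≤ + n ℤ.* v ℤ.+ + (i * r)) (sym (line-split r i≤n)) le))
  where
  cancel : ∀ a c → a ℤ.+ c ℤ.- c ≡ a
  cancel = solve-∀

above-excess⇒< : ∀ r d v → + suc r ℤ.+ (+ (d * r) ℤ.- + r) ℤ.≤ + d ℤ.* v ℤ.+ + 0 → + r ℤ.< v
above-excess⇒< r d v le = ℤP.*-cancelˡ-<-nonNeg (+ d) (subst (ℤ._< + d ℤ.* v) (ℤP.pos-* d r)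
  (ℤP.suc[i]≤j⇒i<j (subst₂ ℤ._≤_ (excess (+ r) (+ (d * r))) (ℤP.+-identityʳ (+ d ℤ.* v)) le)))
  where
  excess : ∀ r x → + 1 ℤ.+ r ℤ.+ (x ℤ.- r) ≡ + 1 ℤ.+ x
  excess = solve-∀

module PureSubstitution (p : ℕ) (p-prime : Prime p) where
  open Valuation p p-prime
  open NewtonLine p p-prime

  PolyAbove-pure : ∀ {r f} (f-pure : IsPure p r f) → PolyAbove (proj₁ f-pure) r (+ (proj₁ f-pure * r)) f
  PolyAbove-pure {r} {f} (n , _ , _ , ν-const , _) zero =
    lies-above (valIs⇒ν {coeff f 0} ν-const) (ℤP.≤-reflexive (trans (ℤP.pos-* n r) (sym (ℤP.+-identityʳ _))))
  PolyAbove-pure {r} {f} (n , _ , _ , _ , middle) (suc i) with ℕP.<-cmp (suc i) n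
  ... | tri< i<n _ _ with middle (suc i) (s≤s z≤n) i<n
  ...   | inj₁ fᵢ≡0           = vanishes fᵢ≡0
  ...   | inj₂ (v , ν-fᵢ , le) = lies-above (valIs⇒ν {coeff f (suc i)} ν-fᵢ) (line⇒above r n (suc i) v (ℕP.<⇒≤ i<n) le)
  PolyAbove-pure {r} {f} (n , _ , ν-lead , _ , _) (suc i) | tri≈ _ refl _ =
    lies-above (valIs⇒ν {coeff f n} ν-lead)
      (ℤP.≤-reflexive (sym (trans (cong (ℤ._+ + (n * r)) (ℤP.*-zeroʳ (+ n))) (ℤP.+-identityˡ _))))
  PolyAbove-pure (n , (_ , deg-f) , _) (suc i) | tri> _ _ n<i = vanishes (deg-f (suc i) n<i)

  PolyAbove⇒slope-condition : ∀ {r n q} → PolyAbove n r (+ (n * r)) q → ∀ i → 1 ≤ i → i < n →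
    (coeff q i ≡ 0ℚ) ⊎ (Σ ℤ λ j → ValIs p (coeff q i) j × (+ (r * (n ∸ i)) ℤ.≤ + n ℤ.* j))
  PolyAbove⇒slope-condition {r} {n} {q} q-above i _ i<n with q-above i
  ... | vanishes qᵢ≡0    = inj₁ qᵢ≡0
  ... | lies-above ν-qᵢ le = inj₂ (_ , ν⇒valIs ν-qᵢ , above⇒line r n i _ (ℕP.<⇒≤ i<n) le)

  module Substitution {r d e s : ℕ} {b : ℚ} {h : Poly}
           (ν-b : ν[ b ]≡ + 0) (deg-h : DegreeLe h e) (h-integral : PolyValGe p (+ 0) h) (r<ds : r < d * s)
           where

    g : Poly
    g = monomial b (suc e) +ₚ scale (P s) h

    private
      coeff-g : ∀ i → coeff g i ≡ coeff (monomial b (suc e)) i ℚ.+ P s ℚ.* coeff h i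
      coeff-g i = trans (coeff-+ₚ (monomial b (suc e)) (scale (P s) h) i)
                        (cong (coeff (monomial b (suc e)) i ℚ.+_) (coeff-scale (P s) h i))

      P-h-vanishes : ∀ i → e < i → P s ℚ.* coeff h i ≡ 0ℚ
      P-h-vanishes i e<i = trans (cong (P s ℚ.*_) (deg-h i e<i)) (ℚP.*-zeroʳ (P s))

    g-degree : DegreeLe g (suc e)
    g-degree i e+1<i = begin
      coeff g i                                                ≡⟨ coeff-g i ⟩
      coeff (monomial b (suc e)) i ℚ.+ P s ℚ.* coeff h i       ≡⟨ cong₂ ℚ._+_ (coeff-monomial-≢ b (suc e) i i≢e+1)
                                                                    (P-h-vanishes i (ℕP.<-trans (ℕP.n<1+n e) e+1<i)) ⟩
      0ℚ ℚ.+ 0ℚ                                                ≡⟨ ℚP.+-identityˡ 0ℚ ⟩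
      0ℚ                                                       ∎
      where
      open ≡-Reasoning
      i≢e+1 : i ≢ suc e
      i≢e+1 i≡e+1 = ℕP.<-irrefl (sym i≡e+1) e+1<i

    g-leading : coeff g (suc e) ≡ b
    g-leading = begin
      coeff g (suc e)                                                    ≡⟨ coeff-g (suc e) ⟩
      coeff (monomial b (suc e)) (suc e) ℚ.+ P s ℚ.* coeff h (suc e)     ≡⟨ cong₂ ℚ._+_ (coeff-monomial-≡ b (suc e))
                                                                              (P-h-vanishes (suc e) (ℕP.n<1+n e)) ⟩
      b ℚ.+ 0ℚ                                                           ≡⟨ ℚP.+-identityʳ b ⟩
      b                                                                  ∎
      where open ≡-Reasoning

    g-above-slope-r : PolyAbove (d * suc e) r (+ (r * suc e)) g
    g-above-slope-r = PolyAbove-+ₚ (monomial b (suc e)) (scale (P s) h)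
      (PolyAbove-monomial (suc e) ν-b (ℤP.≤-reflexive (cong +_ (ℕP.*-comm r (suc e)))))
      (PolyAbove-scale-P s h h-integral (subst (+ (r * suc e) ℤ.≤_) (ℤP.pos-* (d * suc e) s) (ℤ.+≤+ re≤des)))
      where
      re≤des : r * suc e ≤ d * suc e * s
      re≤des = ℕP.≤-trans (ℕP.*-monoˡ-≤ (suc e) (ℕP.<⇒≤ r<ds)) (ℕP.≤-reflexive (ℕ-xy∙z≈xz∙y d s (suc e)))

    g-above-slope-1+r : PolyAbove d (suc r) (+ suc r) g
    g-above-slope-1+r = PolyAbove-+ₚ (monomial b (suc e)) (scale (P s) h)
      (PolyAbove-monomial (suc e) ν-b (ℤ.+≤+ (ℕP.m≤n*m (suc r) (suc e))))
      (PolyAbove-scale-P s h h-integral (subst (+ suc r ℤ.≤_) (ℤP.pos-* d s) (ℤ.+≤+ r<ds)))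

    ∘ₚ-leading : ∀ {f} → HasDegree f d → ValIs p (coeff f d) (+ 0) →
                 HasDegree (f ∘ₚ g) (d * suc e) × ν[ coeff (f ∘ₚ g) (d * suc e) ]≡ + 0
    ∘ₚ-leading {f} (_ , deg-f) ν-lead = (ν⇒≢0 ν-top , proj₁ top) , ν-top
      where
      top : DegreeLe (f ∘ₚ g) (d * suc e) × (coeff (f ∘ₚ g) (d * suc e) ≡ coeff f d ℚ.* qpow (coeff g (suc e)) d)
      top = ∘ₚ-top f g d e deg-f g-degree
      leading≡ : coeff (f ∘ₚ g) (d * suc e) ≡ coeff f d ℚ.* qpow b d
      leading≡ = trans (proj₂ top) (cong (λ c → coeff f d ℚ.* qpow c d) g-leading)
      ν-top : ν[ coeff (f ∘ₚ g) (d * suc e) ]≡ + 0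
      ν-top = subst₂ ν[_]≡_ (sym leading≡) (cong (ℤ._+_ (+ 0)) (ℤP.*-zeroʳ (+ d)))
                (ν-* (valIs⇒ν {coeff f d} ν-lead) (ν-qpow ν-b d))

    ∘ₚ-above : ∀ {f} → PolyAbove d r (+ (d * r)) f → PolyAbove (d * suc e) r (+ (d * suc e * r)) (f ∘ₚ g)
    ∘ₚ-above {f} f-above i = Above-resp-≡ target≡
      (PolyAbove-∘ₚ f g (λ j → Above-scale (suc e) (f-above j)) g-above-slope-r i)
      where
      target≡ : + (d * r) ℤ.* + suc e ≡ + (d * suc e * r)
      target≡ = trans (sym (ℤP.pos-* (d * r) (suc e))) (cong +_ (ℕ-xy∙z≈xz∙y d r (suc e)))

    private
      tail-above : ∀ c f₁ → PolyAbove d r (+ (d * r)) (c ∷ f₁) → PolyAbove d (suc r) (+ (d * r) ℤ.- + r) (f₁ ∘ₚ g)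
      tail-above c f₁ f-above =
        PolyAbove-∘ₚ f₁ g (λ i → Above-mono-B (ℕP.n≤1+n r) (Above-suc⁻ (f-above (suc i)))) g-above-slope-1+r

    ∘ₚ-constant : ∀ f → ValIs p (coeff f 0) (+ r) → PolyAbove d r (+ (d * r)) f → ν[ coeff (f ∘ₚ g) 0 ]≡ + r
    ∘ₚ-constant []       ν-f₀ _ = ⊥-elim (ν⇒≢0 (valIs⇒ν {0ℚ} ν-f₀) refl)
    ∘ₚ-constant (c ∷ f₁) ν-c f-above
      with PolyAbove-*ₚ g (f₁ ∘ₚ g) g-above-slope-1+r (tail-above c f₁ f-above) 0
    ... | vanishes rest≡0 = subst (ν[_]≡ + r) (sym c+rest≡c) (valIs⇒ν {c} ν-c)
      where
      c+rest≡c : coeff ((c ∷ f₁) ∘ₚ g) 0 ≡ c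
      c+rest≡c = trans (coeff-+ₚ (c ∷ []) (g *ₚ (f₁ ∘ₚ g)) 0) (trans (cong (c ℚ.+_) rest≡0) (ℚP.+-identityʳ c))
    ... | lies-above {v} ν-rest le = subst (ν[_]≡ + r) (sym (coeff-+ₚ (c ∷ []) (g *ₚ (f₁ ∘ₚ g)) 0))
      (ν-+-< (valIs⇒ν {c} ν-c) ν-rest (above-excess⇒< r d v le))

    ∘ₚ-pure : ∀ {f} → IsPure p r f → HasDegree f d → IsPure p r (f ∘ₚ g)
    ∘ₚ-pure {f} (n , deg-n , ν-lead , ν-const , middle) deg-f with HasDegree-unique {f} deg-n deg-f
    ... | refl =
      d * suc e , proj₁ leading , ν⇒valIs (proj₂ leading) , ν⇒valIs (∘ₚ-constant f ν-const f-above) ,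
      PolyAbove⇒slope-condition {q = f ∘ₚ g} (∘ₚ-above {f} f-above)
      where
      f-above : PolyAbove d r (+ (d * r)) f
      f-above = PolyAbove-pure {f = f} (d , deg-n , ν-lead , ν-const , middle)
      leading : HasDegree (f ∘ₚ g) (d * suc e) × ν[ coeff (f ∘ₚ g) (d * suc e) ]≡ + 0
      leading = ∘ₚ-leading {f} deg-f ν-lead

theorem3p7 : (p r d e s : ℕ) (f h : Poly) (b : ℚ) →
    Prime p → 1 ≤ r →
    IsPure p r f → HasDegree f d → 1 < d →
    1 ≤ e → ValIs p b (+ 0) →
    DegreeLe h (e ∸ 1) → PolyValGe p (+ 0) h →
    r < d * s →
    IsPure p r (f ∘ₚ (monomial b e +ₚ scale (qpow (ι p) s) h))
theorem3p7 p r d zero    s f h b p-prime _ f-pure deg-f _ () ν-b deg-h h-integral r<ds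
theorem3p7 p r d (suc e) s f h b p-prime _ f-pure deg-f _ _ ν-b deg-h h-integral r<ds =
  ∘ₚ-pure {f} f-pure deg-f
  where
  open Valuation p p-prime using (valIs⇒ν)
  open PureSubstitution p p-prime
  open Substitution {r} {d} {e} {s} {b} {h} (valIs⇒ν {b} ν-b) deg-h h-integral r<ds
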